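{- In the core theory of exceptions $T_{excore}$: (1) for all pure terms $u_1^{(0)},u_2^{(0)}:X\to P$, the equation $u_1\equiv u_2$ is $T_{excore}$-equivalent to $\mathtt{tag}\circ u_1\equiv\mathtt{tag}\circ u_2$, and also to $\mathtt{untag}\circ\mathtt{tag}\circ u_1\equiv\mathtt{untag}\circ\mathtt{tag}\circ u_2$; (2) for all pure terms $u^{(0)}:X\to P$ and $v^{(0)}:X\to\mathbb{0}$, the equation $u\equiv[\,]_P\circ v$ is $T_{excore}$-equivalent to $\mathtt{tag}\circ u\equiv v$.
   Context: Monadic equational logic $L_{eqn}$ (with empty type): types and terms generated by a signature of unary operations, terms being composable paths (with identities); there is an empty type $\mathbb{0}$ with a term $[\,]_Y:\mathbb{0}\to Y$ for each $Y$. Rules: $\equiv$ is an equivalence relation; (subs) from $v_1\equiv v_2:Y\to Z$ and $u:X\to Y$ infer $v_1\circ u\equiv v_2\circ u$; (repl) from $v_1\equiv v_2:X\to Y$ and $w:Y\to Z$ infer $w\circ v_1\equiv w\circ v_2$; (initial) every $u:\mathbb{0}\to Y$ satisfies $u\equiv[\,]_Y$. Decorated logic for the core language of exceptions $L_{excore}$: pure part $L_{eqn}$ with a distinguished type $P$. Terms are composites of pure terms and the two operations $\mathtt{tag}:P\to\mathbb{0}$ (decoration $(1)$) and $\mathtt{untag}:\mathbb{0}\to P$ (decoration $(2)$); a composite has decoration the maximum of its components' decorations; pure terms have decoration $(0)$. Terms of decoration at most $(1)$ are propagators, all terms are catchers. Formulas are strong equations $f\equiv g$ and weak equations $f\sim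 g$ between parallel terms. Rules: for $\equiv$: equivalence, (subs), (repl) for all decorations; for $\sim$: equivalence and (repl) for all decorations, and (subs) (from $v_1\sim v_2:Y\to Z$ and $u:X\to Y$ infer $v_1\circ u\sim v_2\circ u$) only when $u$ is pure; (empty$_\sim$) every $f:\mathbb{0}\to Y$ satisfies $f\sim[\,]_Y$; ($\equiv$-to-$\sim$) $f\equiv g$ implies $f\sim g$; (ax) $\mathtt{untag}\circ\mathtt{tag}\sim\mathrm{id}_P$; (eq$_1$) if $f_1\sim f_2$ and both $f_1,f_2$ are propagators then $f_1\equiv f_2$; (eq$_2$) for $f_1,f_2:X\to Y$, if $f_1\sim f_2$ and $f_1\circ[\,]_X\equiv f_2\circ[\,]_X$ then $f_1\equiv f_2$; (eq$_3$) for $f_1,f_2:\mathbb{0}\to X$, if $f_1\circ\mathtt{tag}\sim f_2\circ\mathtt{tag}$ then $f_1\equiv f_2$. Also all rules of $L_{eqn}$ for pure terms. A theory is a set of formulas closed under the rules. $T_{excore}$ is the theory of $L_{excore}$ generated by a fixed theory $T_{eqn}$ of $L_{eqn}$. $\mathrm{Th}(E)$ is the theory generated by $E$; $T+T'$ the theory generated by $T\cup T'$; sets $E_1,E_2$ of formulas are $T$-equivalent if $T+\mathrm{Th}(E_1)=T+\mathrm{Th}(E_2)$. -}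

module Defs where

open import Data.Nat using (ℕ; zero; suc; _≤_; _⊔_)
open import Data.Product using (_×_; _,_)
open import Data.Sum using (_⊎_)
import Data.Empty
open import Relation.Binary.PropositionalEquality using (_≡_)
open import Relation.Binary.Construct.Closure.ReflexiveTransitive
  using (Star; ε; _◅_; _◅◅_)

data Ty (B : Set) : Set where
  𝟘   : Ty B
  ⌜_⌝ : B → Ty B

record Sig : Set₁ where
  field
    Base : Set
    Op   : Ty Base → Ty Base → Set
    P    : Base

module Lang (S : Sig) where
  open Sig S public

  Type : Set
  Type = Ty Base

  data Atom : Type → Type → Set where
    op    : ∀ {X Y} → Op X Y → Atom X Y
    emp   : ∀ Y → Atom 𝟘 Y
    tag   : Atom ⌜ P ⌝ 𝟘
    untag : Atom 𝟘 ⌜ P ⌝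

  -- terms are composable paths of atoms (first atom applied first);
  -- the empty path is the identity.  Composition is strictly associative
  -- and unital on paths.
  Term : Type → Type → Set
  Term = Star Atom

  id : ∀ {X} → Term X X
  id = ε

  infixr 9 _∘_
  _∘_ : ∀ {X Y Z} → Term Y Z → Term X Y → Term X Z
  g ∘ f = f ◅◅ g

  ⟦_⟧ : ∀ {X Y} → Atom X Y → Term X Y
  ⟦ a ⟧ = a ◅ ε

  []_ : ∀ Y → Term 𝟘 Y
  [] Y = ⟦ emp Y ⟧

  tagₜ : Term ⌜ P ⌝ 𝟘
  tagₜ = ⟦ tag ⟧

  untagₜ : Term 𝟘 ⌜ P ⌝
  untagₜ = ⟦ untag ⟧

  -- decorations: pure (0), propagator (1), catcher (2); composite = max
  decA : ∀ {X Y} → Atom X Y → ℕ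
  decA (op _)  = 0
  decA (emp _) = 0
  decA tag     = 1
  decA untag   = 2

  dec : ∀ {X Y} → Term X Y → ℕ
  dec ε       = 0
  dec (a ◅ t) = decA a ⊔ dec t

  Pure : ∀ {X Y} → Term X Y → Set
  Pure t = dec t ≡ 0

  Propagator : ∀ {X Y} → Term X Y → Set
  Propagator t = dec t ≤ 1

  -- formulas: strong equations and weak equations between parallel terms
  infix 4 _≣_ _∼_
  data Formula : Set where
    _≣_ : ∀ {X Y} → Term X Y → Term X Y → Formula
    _∼_ : ∀ {X Y} → Term X Y → Term X Y → Formula

  infix 3 _⊢_
  data _⊢_ (E : Formula → Set) : Formula → Set where
    hyp      : ∀ {φ} → E φ → E ⊢ φ
    ≣-refl   : ∀ {X Y} (f : Term X Y) → E ⊢ f ≣ f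
    ≣-sym    : ∀ {X Y} {f g : Term X Y} → E ⊢ f ≣ g → E ⊢ g ≣ f
    ≣-trans  : ∀ {X Y} {f g h : Term X Y} → E ⊢ f ≣ g → E ⊢ g ≣ h → E ⊢ f ≣ h
    ≣-subs   : ∀ {X Y Z} {v₁ v₂ : Term Y Z} (u : Term X Y) →
               E ⊢ v₁ ≣ v₂ → E ⊢ v₁ ∘ u ≣ v₂ ∘ u
    ≣-repl   : ∀ {X Y Z} {v₁ v₂ : Term X Y} (w : Term Y Z) →
               E ⊢ v₁ ≣ v₂ → E ⊢ w ∘ v₁ ≣ w ∘ v₂
    ∼-refl   : ∀ {X Y} (f : Term X Y) → E ⊢ f ∼ f
    ∼-sym    : ∀ {X Y} {f g : Term X Y} → E ⊢ f ∼ g → E ⊢ g ∼ f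
    ∼-trans  : ∀ {X Y} {f g h : Term X Y} → E ⊢ f ∼ g → E ⊢ g ∼ h → E ⊢ f ∼ h
    ∼-subs   : ∀ {X Y Z} {v₁ v₂ : Term Y Z} (u : Term X Y) → Pure u →
               E ⊢ v₁ ∼ v₂ → E ⊢ v₁ ∘ u ∼ v₂ ∘ u
    ∼-repl   : ∀ {X Y Z} {v₁ v₂ : Term X Y} (w : Term Y Z) →
               E ⊢ v₁ ∼ v₂ → E ⊢ w ∘ v₁ ∼ w ∘ v₂
    empty∼   : ∀ {Y} (f : Term 𝟘 Y) → E ⊢ f ∼ [] Y
    ≣⇒∼      : ∀ {X Y} {f g : Term X Y} → E ⊢ f ≣ g → E ⊢ f ∼ g
    ax       : E ⊢ untagₜ ∘ tagₜ ∼ id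
    eq₁      : ∀ {X Y} {f₁ f₂ : Term X Y} → Propagator f₁ → Propagator f₂ →
               E ⊢ f₁ ∼ f₂ → E ⊢ f₁ ≣ f₂
    eq₂      : ∀ {X Y} {f₁ f₂ : Term X Y} → E ⊢ f₁ ∼ f₂ →
               E ⊢ f₁ ∘ [] X ≣ f₂ ∘ [] X → E ⊢ f₁ ≣ f₂
    eq₃      : ∀ {X} {f₁ f₂ : Term 𝟘 X} → E ⊢ f₁ ∘ tagₜ ∼ f₂ ∘ tagₜ → E ⊢ f₁ ≣ f₂
    -- rules of L_eqn for pure terms (the only one not already covered: initial)
    initial  : ∀ {Y} (u : Term 𝟘 Y) → Pure u → E ⊢ u ≣ [] Y

  FSet : Set₁
  FSet = Formula → Set

  Th : FSet → FSet
  Th E φ = E ⊢ φ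

  _∪_ : FSet → FSet → FSet
  (A ∪ B) φ = A φ ⊎ B φ

  _⊕_ : FSet → FSet → FSet
  T ⊕ T' = Th (T ∪ T')

  _≐_ : FSet → FSet → Set
  A ≐ B = ∀ φ → (A φ → B φ) × (B φ → A φ)

  Equivalent : FSet → FSet → FSet → Set
  Equivalent T E₁ E₂ = (T ⊕ Th E₁) ≐ (T ⊕ Th E₂)

  ⟅_⟆ : Formula → FSet
  ⟅ φ ⟆ ψ = ψ ≡ φ

  record IsEqnTheory (T : FSet) : Set where
    field
      onlyPure : ∀ {X Y} {f g : Term X Y} → T (f ≣ g) → Pure f × Pure g
      noWeak   : ∀ {X Y} {f g : Term X Y} → T (f ∼ g) → Data.Empty.⊥
      refl'    : ∀ {X Y} (f : Term X Y) → Pure f → T (f ≣ f)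
      sym'     : ∀ {X Y} {f g : Term X Y} → T (f ≣ g) → T (g ≣ f)
      trans'   : ∀ {X Y} {f g h : Term X Y} → T (f ≣ g) → T (g ≣ h) → T (f ≣ h)
      subs'    : ∀ {X Y Z} {v₁ v₂ : Term Y Z} (u : Term X Y) → Pure u →
                 T (v₁ ≣ v₂) → T (v₁ ∘ u ≣ v₂ ∘ u)
      repl'    : ∀ {X Y Z} {v₁ v₂ : Term X Y} (w : Term Y Z) → Pure w →
                 T (v₁ ≣ v₂) → T (w ∘ v₁ ≣ w ∘ v₂)
      initial' : ∀ {Y} (u : Term 𝟘 Y) → Pure u → T (u ≣ [] Y)

  Texcore : FSet → FSet
  Texcore Teqn = Th Teqn

-- For a pure u : X → P, rule (subs) applied to (ax) gives untag ∘ tag ∘ u ∼ u,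
-- so untag ∘ tag undoes tag up to weak equality on pure terms.  Pure terms are
-- propagators, and by (eq₁) weak equality between propagators is strong; this
-- recovers u₁ ≣ u₂ from tag ∘ u₁ ≣ tag ∘ u₂, and u ≣ [ ] ∘ v from tag ∘ u ≣ v.
-- Conversely tag ∘ [ ]_P ≣ id_𝟘, both being propagators out of 𝟘, which turns
-- u ≣ [ ] ∘ v into tag ∘ u ≣ v.
module Submission where

open import Defs
open import Data.Nat using (_⊔_; z≤n; s≤s)
open import Data.Nat.Properties using (⊔-assoc)
open import Data.Product using (_×_; _,_)
open import Data.Sum using (inj₁; inj₂)
open import Relation.Binary.PropositionalEquality
  using (_≡_; refl; sym; trans; cong; cong₂)
open import Relation.Binary.Construct.Closure.ReflexiveTransitive
  using (ε; _◅_)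
open import Relation.Binary.Construct.Closure.ReflexiveTransitive.Properties
  using (◅◅-assoc)

module Excore (S : Sig) where
  open Lang S

  ∘-assoc : ∀ {W X Y Z} (h : Term Y Z) (g : Term X Y) (f : Term W X) →
            (h ∘ g) ∘ f ≡ h ∘ (g ∘ f)
  ∘-assoc h g f = sym (◅◅-assoc f g h)

  ∘-identityˡ : ∀ {X Y} (f : Term X Y) → id ∘ f ≡ f
  ∘-identityˡ ε       = refl
  ∘-identityˡ (a ◅ f) = cong (a ◅_) (∘-identityˡ f)

  dec-∘ : ∀ {X Y Z} (g : Term Y Z) (f : Term X Y) → dec (g ∘ f) ≡ dec f ⊔ dec g
  dec-∘ g ε       = refl
  dec-∘ g (a ◅ f) =
    trans (cong (decA a ⊔_) (dec-∘ g f)) (sym (⊔-assoc (decA a) (dec f) (dec g)))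

  Pure-∘ : ∀ {X Y Z} (g : Term Y Z) (f : Term X Y) → Pure g → Pure f → Pure (g ∘ f)
  Pure-∘ g f pg pf = trans (dec-∘ g f) (cong₂ _⊔_ pf pg)

  Pure⇒Propagator : ∀ {X Y} (f : Term X Y) → Pure f → Propagator f
  Pure⇒Propagator f pf rewrite pf = z≤n

  ⊢-bind : ∀ {A B : FSet} → (∀ {ψ} → A ψ → B ⊢ ψ) → ∀ {φ} → A ⊢ φ → B ⊢ φ
  ⊢-bind σ (hyp a)         = σ a
  ⊢-bind σ (≣-refl f)      = ≣-refl f
  ⊢-bind σ (≣-sym d)       = ≣-sym (⊢-bind σ d)
  ⊢-bind σ (≣-trans d e)   = ≣-trans (⊢-bind σ d) (⊢-bind σ e)
  ⊢-bind σ (≣-subs u d)    = ≣-subs u (⊢-bind σ d)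
  ⊢-bind σ (≣-repl w d)    = ≣-repl w (⊢-bind σ d)
  ⊢-bind σ (∼-refl f)      = ∼-refl f
  ⊢-bind σ (∼-sym d)       = ∼-sym (⊢-bind σ d)
  ⊢-bind σ (∼-trans d e)   = ∼-trans (⊢-bind σ d) (⊢-bind σ e)
  ⊢-bind σ (∼-subs u pu d) = ∼-subs u pu (⊢-bind σ d)
  ⊢-bind σ (∼-repl w d)    = ∼-repl w (⊢-bind σ d)
  ⊢-bind σ (empty∼ f)      = empty∼ f
  ⊢-bind σ (≣⇒∼ d)         = ≣⇒∼ (⊢-bind σ d)
  ⊢-bind σ ax              = ax
  ⊢-bind σ (eq₁ p₁ p₂ d)   = eq₁ p₁ p₂ (⊢-bind σ d)
  ⊢-bind σ (eq₂ d e)       = eq₂ (⊢-bind σ d) (⊢-bind σ e)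
  ⊢-bind σ (eq₃ d)         = eq₃ (⊢-bind σ d)
  ⊢-bind σ (initial u pu)  = initial u pu

  ⊕-Th-mono : ∀ (T : FSet) {E₁ E₂ : FSet} → (∀ {ψ} → E₁ ψ → E₂ ⊢ ψ) →
              ∀ φ → (T ⊕ Th E₁) φ → (T ⊕ Th E₂) φ
  ⊕-Th-mono T {E₁} {E₂} E₁⊆E₂ φ = ⊢-bind σ
    where
      σ : ∀ {ψ} → (T ∪ Th E₁) ψ → (T ∪ Th E₂) ⊢ ψ
      σ (inj₁ t) = hyp (inj₁ t)
      σ (inj₂ d) = ⊢-bind (λ e → hyp (inj₂ (E₁⊆E₂ e))) d

  interderivable⇒Equivalent : ∀ (T : FSet) {E₁ E₂ : FSet} →
    (∀ {ψ} → E₁ ψ → E₂ ⊢ ψ) → (∀ {ψ} → E₂ ψ → E₁ ⊢ ψ) → Equivalent T E₁ E₂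
  interderivable⇒Equivalent T E₁⊆E₂ E₂⊆E₁ φ =
    ⊕-Th-mono T E₁⊆E₂ φ , ⊕-Th-mono T E₂⊆E₁ φ

  ⟅⟆-Equivalent : ∀ (T : FSet) {φ₁ φ₂ : Formula} →
    (∀ {B} → B ⊢ φ₁ → B ⊢ φ₂) → (∀ {B} → B ⊢ φ₂ → B ⊢ φ₁) →
    Equivalent T ⟅ φ₁ ⟆ ⟅ φ₂ ⟆
  ⟅⟆-Equivalent T φ₁⇒φ₂ φ₂⇒φ₁ = interderivable⇒Equivalent T
    (λ { refl → φ₂⇒φ₁ (hyp refl) }) (λ { refl → φ₁⇒φ₂ (hyp refl) })

  module _ {B : FSet} where

    ≡⇒≣ : ∀ {X Y} {f g : Term X Y} → f ≡ g → B ⊢ f ≣ g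
    ≡⇒≣ {f = f} refl = ≣-refl f

    ≡⇒∼ : ∀ {X Y} {f g : Term X Y} → f ≡ g → B ⊢ f ∼ g
    ≡⇒∼ {f = f} refl = ∼-refl f

    pure-∼⇒≣ : ∀ {X Y} {f g : Term X Y} → Pure f → Pure g → B ⊢ f ∼ g → B ⊢ f ≣ g
    pure-∼⇒≣ {f = f} {g} pf pg = eq₁ (Pure⇒Propagator f pf) (Pure⇒Propagator g pg)

    propagator-from-𝟘≣[] : ∀ {Y} {f : Term 𝟘 Y} → Propagator f → B ⊢ f ≣ [] Y
    propagator-from-𝟘≣[] {f = f} pf = eq₁ pf z≤n (empty∼ f)

    tag∘[]≣id : B ⊢ tagₜ ∘ [] ⌜ P ⌝ ≣ id
    tag∘[]≣id = ≣-trans (propagator-from-𝟘≣[] (s≤s z≤n)) (≣-sym (propagator-from-𝟘≣[] z≤n))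

    untag∘tag∘pure∼ : ∀ {X} {u : Term X ⌜ P ⌝} → Pure u → B ⊢ untagₜ ∘ tagₜ ∘ u ∼ u
    untag∘tag∘pure∼ {u = u} pu =
      ∼-trans (≡⇒∼ (sym (∘-assoc untagₜ tagₜ u)))
        (∼-trans (∼-subs u pu ax) (≡⇒∼ (∘-identityˡ u)))

    untag∘tag-cancel : ∀ {X} {u₁ u₂ : Term X ⌜ P ⌝} → Pure u₁ → Pure u₂ →
      B ⊢ untagₜ ∘ tagₜ ∘ u₁ ≣ untagₜ ∘ tagₜ ∘ u₂ → B ⊢ u₁ ≣ u₂
    untag∘tag-cancel p₁ p₂ d = pure-∼⇒≣ p₁ p₂
      (∼-trans (∼-sym (untag∘tag∘pure∼ p₁)) (∼-trans (≣⇒∼ d) (untag∘tag∘pure∼ p₂)))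

    tag-cancel : ∀ {X} {u₁ u₂ : Term X ⌜ P ⌝} → Pure u₁ → Pure u₂ →
      B ⊢ tagₜ ∘ u₁ ≣ tagₜ ∘ u₂ → B ⊢ u₁ ≣ u₂
    tag-cancel p₁ p₂ d = untag∘tag-cancel p₁ p₂ (≣-repl untagₜ d)

    tag∘≣-from-≣[]∘ : ∀ {X} {u : Term X ⌜ P ⌝} {v : Term X 𝟘} →
      B ⊢ u ≣ [] ⌜ P ⌝ ∘ v → B ⊢ tagₜ ∘ u ≣ v
    tag∘≣-from-≣[]∘ {v = v} d =
      ≣-trans (≣-repl tagₜ d)
        (≣-trans (≡⇒≣ (sym (∘-assoc tagₜ ([] ⌜ P ⌝) v)))
          (≣-trans (≣-subs v tag∘[]≣id) (≡⇒≣ (∘-identityˡ v))))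

    ≣[]∘-from-tag∘≣ : ∀ {X} {u : Term X ⌜ P ⌝} {v : Term X 𝟘} → Pure u → Pure v →
      B ⊢ tagₜ ∘ u ≣ v → B ⊢ u ≣ [] ⌜ P ⌝ ∘ v
    ≣[]∘-from-tag∘≣ {v = v} pu pv d = pure-∼⇒≣ pu (Pure-∘ ([] ⌜ P ⌝) v refl pv)
      (∼-trans (∼-sym (untag∘tag∘pure∼ pu))
        (∼-trans (≣⇒∼ (≣-repl untagₜ d)) (∼-subs v pv (empty∼ untagₜ))))

lemma4p1 : (S : Sig) → let open Lang S in
    (Teqn : FSet) → IsEqnTheory Teqn →
    (∀ {X} (u₁ u₂ : Term X ⌜ P ⌝) → Pure u₁ → Pure u₂ →
       Equivalent (Texcore Teqn) ⟅ u₁ ≣ u₂ ⟆ ⟅ tagₜ ∘ u₁ ≣ tagₜ ∘ u₂ ⟆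
       × Equivalent (Texcore Teqn) ⟅ u₁ ≣ u₂ ⟆
           ⟅ untagₜ ∘ tagₜ ∘ u₁ ≣ untagₜ ∘ tagₜ ∘ u₂ ⟆)
    × (∀ {X} (u : Term X ⌜ P ⌝) (v : Term X 𝟘) → Pure u → Pure v →
       Equivalent (Texcore Teqn) ⟅ u ≣ [] ⌜ P ⌝ ∘ v ⟆ ⟅ tagₜ ∘ u ≣ v ⟆)
lemma4p1 S Teqn _ =
    (λ u₁ u₂ p₁ p₂ →
        ⟅⟆-Equivalent T (≣-repl tagₜ) (tag-cancel p₁ p₂)
      , ⟅⟆-Equivalent T (λ d → ≣-repl untagₜ (≣-repl tagₜ d)) (untag∘tag-cancel p₁ p₂))
  , (λ u v pu pv → ⟅⟆-Equivalent T tag∘≣-from-≣[]∘ (≣[]∘-from-tag∘≣ pu pv))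
  where
    open Lang S
    open Excore S
    T : FSet
    T = Texcore Teqn
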